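{- Let $b\ge 2$ and $m\ge 1$ be integers, and define $f:\mathbb{Z}_{>0}\to\mathbb{Z}_{>0}$ by $f(n)=n/b$ if $n\equiv 0 \pmod b$, and $f(n)=(b^{m}+1)n+b^{m}-(n \bmod b^{m})$ if $n\not\equiv 0\pmod b$, where $n \bmod b^m$ denotes the least nonnegative residue of $n$ modulo $b^m$. Let $S_0$ be a positive integer with $S_0<b^{m}$, and define $S_k=f(S_{k-1})$ for $k=1,2,\dots$. Then there exists $k\ge 0$ with $S_k=1$. -}

module Defs where

open import Data.Nat.Base
open import Data.Nat.DivMod using (_/_; _%_)
open import Data.Nat.Properties using (m^n≢0)

-- The map f from the paper, for base b (nonzero) and exponent m:
--   f(n) = n / b                                   if n ≡ 0 (mod b)
--   f(n) = (b^m + 1) n + b^m - (n mod b^m)          otherwise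
-- (b^m - (n mod b^m) ≥ 1, so truncated subtraction is exact here.)
f : (b m : ℕ) .{{_ : NonZero b}} → ℕ → ℕ
f b m n with n % b
... | zero  = n / b
... | suc _ = (b ^ m + 1) * n + (b ^ m ∸ (_%_ n (b ^ m) {{m^n≢0 b m}}))

iter : (b m : ℕ) .{{_ : NonZero b}} → ℕ → ℕ → ℕ
iter b m S₀ zero    = S₀
iter b m S₀ (suc k) = f b m (iter b m S₀ k)

{-# OPTIONS --safe #-}
module Submission where

open import Defs
open import Data.Nat.Base
open import Data.Nat.DivMod using (_/_; _%_; m≡m%n+[m/n]*n; m%n<n; m*n%n≡0; m*n/n≡m; [m+kn]%n≡m%n; m<n⇒m%n≡m)
open import Data.Nat.Induction using (<-rec)
open import Data.Nat.Properties
open import Data.Product using (∃-syntax; _,_)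
open import Function using (_∘_)
open import Relation.Nullary using (yes; no)
open import Relation.Binary.PropositionalEquality

-- Below b^m, a number t not divisible by b is sent to b^m (t + 1), which the
-- next m steps divide back down to t + 1. So from t = q b + r with 0 < r < b the
-- orbit climbs t, t + 1, …, (q + 1) b and then drops to q + 1; a multiple q b
-- drops to q. In both cases the orbit reaches a number strictly below t that is
-- still in [1, b^m] (for m ≥ 1, (q + 1) b ≤ b^m because b^m is a multiple of b),
-- so strong induction on t finishes the proof.

[n+1]*m+[n∸m]≡n*[1+m] : ∀ {m n} → m ≤ n → (n + 1) * m + (n ∸ m) ≡ n * suc m
[n+1]*m+[n∸m]≡n*[1+m] {m} {n} m≤n = begin
  (n + 1) * m + (n ∸ m)    ≡⟨ cong (_+ (n ∸ m)) (*-distribʳ-+ m n 1) ⟩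
  n * m + 1 * m + (n ∸ m)  ≡⟨ +-assoc (n * m) (1 * m) (n ∸ m) ⟩
  n * m + (m + 0 + (n ∸ m)) ≡⟨ cong (λ k → n * m + (k + (n ∸ m))) (+-identityʳ m) ⟩
  n * m + (m + (n ∸ m))    ≡⟨ cong (n * m +_) (m+[n∸m]≡n m≤n) ⟩
  n * m + n                ≡⟨ +-comm (n * m) n ⟩
  n + n * m                ≡⟨ *-suc n m ⟨
  n * suc m                ∎
  where open ≡-Reasoning

m*o<n*o⇒[1+m]*o≤n*o : ∀ m n o → m * o < n * o → suc m * o ≤ n * o
m*o<n*o⇒[1+m]*o≤n*o m n o mo<no = *-monoˡ-≤ o (*-cancelʳ-< o m n mo<no)

module Orbit (b m : ℕ) .{{_ : NonZero b}} where

  Reaches1 : ℕ → Set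
  Reaches1 t = ∃[ k ] iter b m t k ≡ 1

  iter-suc : ∀ t k → iter b m t (suc k) ≡ iter b m (f b m t) k
  iter-suc t zero    = refl
  iter-suc t (suc k) = cong (f b m) (iter-suc t k)

  reaches1-preimage : ∀ t → Reaches1 (f b m t) → Reaches1 t
  reaches1-preimage t (k , fᵏ⁺¹t≡1) = suc k , trans (iter-suc t k) fᵏ⁺¹t≡1

  f-multiple : ∀ q → f b m (q * b) ≡ q
  f-multiple q with (q * b) % b | m*n%n≡0 q b
  ... | .zero | refl = m*n/n≡m q b

  f-indivisible-below : ∀ {t r} → t % b ≡ suc r → t < b ^ m → f b m t ≡ b ^ m * suc t
  f-indivisible-below {t} t%b≡1+r t<bᵐ with t % b | t%b≡1+r
  ... | .(suc _) | refl = begin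
    (b ^ m + 1) * t + (b ^ m ∸ _%_ t (b ^ m) {{m^n≢0 b m}})
      ≡⟨ cong (λ s → (b ^ m + 1) * t + (b ^ m ∸ s)) (m<n⇒m%n≡m {{m^n≢0 b m}} t<bᵐ) ⟩
    (b ^ m + 1) * t + (b ^ m ∸ t)
      ≡⟨ [n+1]*m+[n∸m]≡n*[1+m] (<⇒≤ t<bᵐ) ⟩
    b ^ m * suc t ∎
    where open ≡-Reasoning

  reaches1-*b : ∀ {q} → Reaches1 q → Reaches1 (q * b)
  reaches1-*b {q} = reaches1-preimage (q * b) ∘ subst Reaches1 (sym (f-multiple q))

  reaches1-b^* : ∀ j {x} → Reaches1 x → Reaches1 (b ^ j * x)
  reaches1-b^* zero    {x} = subst Reaches1 (sym (+-identityʳ x))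
  reaches1-b^* (suc j) {x} =
    subst Reaches1 (trans (*-comm (b ^ j * x) b) (sym (*-assoc b (b ^ j) x))) ∘ reaches1-*b ∘ reaches1-b^* j

  reaches1-climb : ∀ q k i → suc i + k ≡ b → suc q * b ≤ b ^ m →
                   Reaches1 (suc q) → Reaches1 (suc i + q * b)
  reaches1-climb q zero    i 1+i+0≡b _ =
    subst (λ c → Reaches1 (c + q * b)) (trans (sym 1+i+0≡b) (+-identityʳ (suc i))) ∘ reaches1-*b
  reaches1-climb q (suc k) i 1+i+1+k≡b [1+q]b≤bᵐ reaches =
    reaches1-preimage t (subst Reaches1 (sym (f-indivisible-below t%b≡1+i t<bᵐ))
      (reaches1-b^* m (reaches1-climb q k (suc i) (trans (sym (+-suc (suc i) k)) 1+i+1+k≡b)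
                                      [1+q]b≤bᵐ reaches)))
    where
    t = suc i + q * b
    1+i<b : suc i < b
    1+i<b = subst (suc i <_) 1+i+1+k≡b (m<m+n (suc i) z<s)
    t%b≡1+i : t % b ≡ suc i
    t%b≡1+i = trans ([m+kn]%n≡m%n (suc i) q b) (m<n⇒m%n≡m 1+i<b)
    t<bᵐ : t < b ^ m
    t<bᵐ = <-≤-trans (+-monoˡ-< (q * b) 1+i<b) [1+q]b≤bᵐ

module _ (b m : ℕ) .{{_ : NonZero b}} (2≤b : 2 ≤ b) where

  open Orbit b (suc m)

  1+q<1+r+q*b : ∀ r q → 2 ≤ suc r + q * b → suc q < suc r + q * b
  1+q<1+r+q*b r zero    2≤t = 2≤t
  1+q<1+r+q*b r (suc q) _   = s≤s (<-≤-trans (m<m*n (suc q) b 2≤b) (m≤n+m (suc q * b) r))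

  reaches1-below : ∀ t → 1 ≤ t → t ≤ b ^ suc m → Reaches1 t
  reaches1-below = <-rec (λ t → 1 ≤ t → t ≤ b ^ suc m → Reaches1 t) step
    where
    step : ∀ t → (∀ {s} → s < t → 1 ≤ s → s ≤ b ^ suc m → Reaches1 s) →
           1 ≤ t → t ≤ b ^ suc m → Reaches1 t
    step t IH 1≤t t≤bᵐ with t ≟ 1 | t % b | t / b | m≡m%n+[m/n]*n t b | m%n<n t b
    ... | yes t≡1 | _ | _ | _ | _ = 0 , t≡1
    ... | no _ | zero | zero | refl | _ with () ← 1≤t
    ... | no _ | zero | suc q | refl | _ =
      reaches1-*b (IH (m<m*n (suc q) b 2≤b) z<s (≤-trans (m≤m*n (suc q) b) t≤bᵐ))
    ... | no t≢1 | suc r | q | refl | 1+r<b =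
      reaches1-climb q (b ∸ suc r) r (m+[n∸m]≡n (<⇒≤ 1+r<b))
                     [1+q]b≤bᵐ
                     (IH 1+q<t z<s (≤-trans (m≤m*n (suc q) b) [1+q]b≤bᵐ))
      where
      1+q<t : suc q < suc r + q * b
      1+q<t = 1+q<1+r+q*b r q (≤∧≢⇒< 1≤t (t≢1 ∘ sym))
      qb<bᵐb : q * b < b ^ m * b
      qb<bᵐb = <-≤-trans (m<n+m (q * b) z<s) (≤-trans t≤bᵐ (≤-reflexive (*-comm b (b ^ m))))
      [1+q]b≤bᵐ : suc q * b ≤ b ^ suc m
      [1+q]b≤bᵐ = subst (suc q * b ≤_) (*-comm (b ^ m) b) (m*o<n*o⇒[1+m]*o≤n*o q (b ^ m) b qb<bᵐb)

mainTheorem1 : (b m : ℕ) .{{_ : NonZero b}} → 2 ≤ b → 1 ≤ m →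
               (S₀ : ℕ) → 1 ≤ S₀ → S₀ < b ^ m →
               ∃[ k ] iter b m S₀ k ≡ 1
mainTheorem1 b (suc m) 2≤b _ S₀ 1≤S₀ S₀<bᵐ = reaches1-below b m 2≤b S₀ 1≤S₀ (<⇒≤ S₀<bᵐ)
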